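{- In the table with $3$ rows, for all $s\ge1$, $\mathcal{D}(s,1)=\mathcal{P}_s$ and $\mathcal{D}(s,2)=\mathcal{Q}_s$. Consequently, for all $s,t\ge1$, \[\mathcal{D}(s,1)\,\mathcal{D}(s+t,2)-\mathcal{D}(s,2)\,\mathcal{D}(s+t,1)=(-1)^{s+1}\mathcal{D}(t,1).\]
   Context: For $m\ge1$, $s\ge1$, $1\le t\le m$, $\mathcal{D}(s,t)$ (in the table with $m$ rows; here $m=3$) is the number of sequences $(r_1,\dots,r_s)$ with $r_i\in\{1,\dots,m\}$, $|r_{i+1}-r_i|\le1$ and $r_s=t$, i.e. the number of lattice paths with steps $(1,0),(1,1),(1,-1)$ from any cell of the first column to the cell in column $s$, row $t$, staying inside the table. Pell numbers: $\mathcal{P}_1=1$, $\mathcal{P}_2=2$, $\mathcal{P}_n=2\mathcal{P}_{n-1}+\mathcal{P}_{n-2}$ ($n\ge3$). Pell–Lucas numbers: $\mathcal{Q}_1=1$, $\mathcal{Q}_2=3$, $\mathcal{Q}_n=2\mathcal{Q}_{n-1}+\mathcal{Q}_{n-2}$ ($n\ge3$). -}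

module Defs where

open import Data.Nat using (ℕ; zero; suc; _+_; _*_; _∸_; _≤_; _≤ᵇ_)
open import Data.Bool using (Bool; true; false; _∧_)
open import Data.List using (List; []; _∷_; map; concatMap; filterᵇ; length; last; upTo)
open import Data.Maybe using (Maybe; just; nothing)

rows : ℕ → List ℕ
rows m = map suc (upTo m)

allSeqs : ℕ → ℕ → List (List ℕ)
allSeqs m zero = [] ∷ []
allSeqs m (suc s) = concatMap (λ r → map (r ∷_) (allSeqs m s)) (rows m)

adj : ℕ → ℕ → Bool
adj a b = ((a ∸ b) ≤ᵇ 1) ∧ ((b ∸ a) ≤ᵇ 1)

adjacentOK : List ℕ → Bool
adjacentOK [] = true
adjacentOK (a ∷ []) = true
adjacentOK (a ∷ b ∷ rs) = adj a b ∧ adjacentOK (b ∷ rs)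

eqᵇ : ℕ → ℕ → Bool
eqᵇ a b = (a ≤ᵇ b) ∧ (b ≤ᵇ a)

endsAt : ℕ → List ℕ → Bool
endsAt t rs with last rs
... | just r = eqᵇ r t
... | nothing = false

D : ℕ → ℕ → ℕ → ℕ
D m s t = length (filterᵇ (λ rs → adjacentOK rs ∧ endsAt t rs) (allSeqs m s))

-- Pell numbers, P 1 = 1, P 2 = 2 (P 0 = 0 is a harmless junk value)
P : ℕ → ℕ
P zero = 0
P (suc zero) = 1
P (suc (suc zero)) = 2
P (suc (suc (suc n))) = 2 * P (suc (suc n)) + P (suc n)

-- Pell–Lucas numbers as in the paper, Q 1 = 1, Q 2 = 3 (Q 0 = 1 junk)
Q : ℕ → ℕ
Q zero = 1
Q (suc zero) = 1
Q (suc (suc zero)) = 3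
Q (suc (suc (suc n))) = 2 * Q (suc (suc n)) + Q (suc n)

-- Admissible sequences are counted from their first entry: if (a, b, c) counts
-- those of length s + 1 starting in rows 1, 2, 3 and ending in a fixed row t,
-- then prepending a row gives (a + b, a + b + c, b + c). Row 2 is adjacent to
-- every row, so its count b is the total D(s, t), and the pair
-- (b, a + c) evolves by (x, y) ↦ (x + y, 2x + y), the recurrence of (P, Q).
-- Starting from (0, 1) for t = 1 and (1, 0) for t = 2 yields (P, Q) and
-- (Q, 2P). The determinant identity holds because the step matrix
-- [[1, 1], [2, 1]] has determinant −1.
module Submission where

open import Defs
open import Data.Nat using (ℕ; _≥_; _+_)
open import Data.Integer using (ℤ; +_; _-_; _*_; -_)
open import Data.Integer using () renaming (_^_ to _^ℤ_)
open import Data.Product using (_×_)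
open import Relation.Binary.PropositionalEquality using (_≡_)

open import Function using (_∘_)
open import Data.Nat as ℕ using (zero; suc)
import Data.Nat.Properties as ℕ
import Data.Integer as ℤ using (_+_)
import Data.Integer.Properties as ℤ
open import Data.Bool using (Bool; true; false; _∧_)
open import Data.List using (List; []; _∷_; _++_; map; concatMap; filterᵇ; length)
open import Data.Nat.ListAction using (sum)
import Data.List.Properties as List
open import Data.Product using (_,_; proj₁; proj₂)
open import Relation.Binary.PropositionalEquality using (refl; cong; cong₂; sym; trans; module ≡-Reasoning)
import Data.Nat.Tactic.RingSolver as ℕ-Solver
import Data.Integer.Tactic.RingSolver as ℤ-Solver

count : {A : Set} → (A → Bool) → List A → ℕ
count p xs = length (filterᵇ p xs)

count-++ : {A : Set} (p : A → Bool) (xs ys : List A) →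
           count p (xs ++ ys) ≡ count p xs + count p ys
count-++ p xs ys = trans (cong length (List.filter-++ _ xs ys)) (List.length-++ (filterᵇ p xs))

count-map : {A B : Set} (p : B → Bool) (f : A → B) (xs : List A) →
            count p (map f xs) ≡ count (p ∘ f) xs
count-map p f [] = refl
count-map p f (x ∷ xs) with p (f x)
... | true  = cong suc (count-map p f xs)
... | false = count-map p f xs

count-concatMap : {A B : Set} (p : B → Bool) (f : A → List B) (xs : List A) →
                  count p (concatMap f xs) ≡ sum (map (count p ∘ f) xs)
count-concatMap p f [] = refl
count-concatMap p f (x ∷ xs) =
  trans (count-++ p (f x) (concatMap f xs)) (cong (count p (f x) ℕ.+_) (count-concatMap p f xs))

count-const-false : {A : Set} (xs : List A) → count (λ _ → false) xs ≡ 0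
count-const-false [] = refl
count-const-false (x ∷ xs) = count-const-false xs

count-allSeqs-suc : (m s : ℕ) (p : List ℕ → Bool) →
  count p (allSeqs m (suc s)) ≡ sum (map (λ r → count (p ∘ (r ∷_)) (allSeqs m s)) (rows m))
count-allSeqs-suc m s p =
  trans (count-concatMap p _ (rows m))
        (cong sum (List.map-cong (λ r → count-map p (r ∷_) (allSeqs m s)) (rows m)))

Dfrom : ℕ → ℕ → ℕ → ℕ → ℕ
Dfrom m s r t = count (λ rs → adjacentOK (r ∷ rs) ∧ endsAt t (r ∷ rs)) (allSeqs m s)

D-suc : (m s t : ℕ) → D m (suc s) t ≡ sum (map (λ r → Dfrom m s r t) (rows m))
D-suc m s t = count-allSeqs-suc m s _

module _ (s t : ℕ) where

  private
    a b c : ℕ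
    a = Dfrom 3 s 1 t
    b = Dfrom 3 s 2 t
    c = Dfrom 3 s 3 t

  D₃-suc : D 3 (suc s) t ≡ b + (a + c)
  D₃-suc = trans (D-suc 3 s t) (swap-sum₃ a b c)
    where
    swap-sum₃ : ∀ x y z → x + (y + (z + 0)) ≡ y + (x + z)
    swap-sum₃ = ℕ-Solver.solve-∀

  Dfrom₃-suc-1 : Dfrom 3 (suc s) 1 t ≡ a + b
  Dfrom₃-suc-1 = begin
    Dfrom 3 (suc s) 1 t                                   ≡⟨ count-allSeqs-suc 3 s _ ⟩
    a + (b + (count (λ _ → false) (allSeqs 3 s) + 0))     ≡⟨ cong (λ k → a + (b + (k + 0))) (count-const-false (allSeqs 3 s)) ⟩
    a + (b + 0)                                           ≡⟨ cong (a ℕ.+_) (ℕ.+-identityʳ b) ⟩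
    a + b                                                 ∎
    where open ≡-Reasoning

  Dfrom₃-suc-2 : Dfrom 3 (suc s) 2 t ≡ D 3 (suc s) t
  Dfrom₃-suc-2 = trans (count-allSeqs-suc 3 s _) (sym (D-suc 3 s t))

  Dfrom₃-suc-3 : Dfrom 3 (suc s) 3 t ≡ b + c
  Dfrom₃-suc-3 = begin
    Dfrom 3 (suc s) 3 t                                   ≡⟨ count-allSeqs-suc 3 s _ ⟩
    count (λ _ → false) (allSeqs 3 s) + (b + (c + 0))     ≡⟨ cong (λ k → k + (b + (c + 0))) (count-const-false (allSeqs 3 s)) ⟩
    b + (c + 0)                                           ≡⟨ cong (b ℕ.+_) (ℕ.+-identityʳ c) ⟩
    b + c                                                 ∎
    where open ≡-Reasoning

record PellPair (x y : ℕ → ℕ) : Set where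
  field
    fst-suc : ∀ n → x (suc n) ≡ x n + y n
    snd-suc : ∀ n → y (suc n) ≡ 2 ℕ.* x n + y n

open PellPair

pellPair-unique : ∀ {x y u v} → PellPair x y → PellPair u v →
                  x 0 ≡ u 0 → y 0 ≡ v 0 → ∀ n → (x n ≡ u n) × (y n ≡ v n)
pellPair-unique {x} {y} {u} {v} xy uv x₀ y₀ = agree
  where
  agree : ∀ n → (x n ≡ u n) × (y n ≡ v n)
  agree zero = x₀ , y₀
  agree (suc n) with agree n
  ... | xₙ , yₙ =
    trans (fst-suc xy n) (trans (cong₂ _+_ xₙ yₙ) (sym (fst-suc uv n))) ,
    trans (snd-suc xy n) (trans (cong₂ (λ p q → 2 ℕ.* p + q) xₙ yₙ) (sym (snd-suc uv n)))

P-Q-suc : ∀ n → (P (suc n) ≡ P n + Q n) × (Q (suc n) ≡ 2 ℕ.* P n + Q n)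
P-Q-suc zero = refl , refl
P-Q-suc (suc zero) = refl , refl
P-Q-suc (suc (suc zero)) = refl , refl
P-Q-suc (suc (suc (suc n))) with P-Q-suc (suc (suc n)) | P-Q-suc (suc n)
... | Pₙ₊₂ , Qₙ₊₂ | Pₙ₊₁ , Qₙ₊₁ =
  trans (cong₂ (λ p q → 2 ℕ.* p + q) Pₙ₊₂ Pₙ₊₁) (regroup p₂ q₂ p₁ q₁) ,
  trans (cong₂ (λ p q → 2 ℕ.* p + q) Qₙ₊₂ Qₙ₊₁) (regroup₂ p₂ q₂ p₁ q₁)
  where
  p₂ = P (suc (suc n))
  q₂ = Q (suc (suc n))
  p₁ = P (suc n)
  q₁ = Q (suc n)
  regroup : ∀ a b c d → 2 ℕ.* (a + b) + (c + d) ≡ (2 ℕ.* a + c) + (2 ℕ.* b + d)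
  regroup = ℕ-Solver.solve-∀
  regroup₂ : ∀ a b c d → 2 ℕ.* (2 ℕ.* a + b) + (2 ℕ.* c + d) ≡ 2 ℕ.* (2 ℕ.* a + c) + (2 ℕ.* b + d)
  regroup₂ = ℕ-Solver.solve-∀

pellPair-PQ : PellPair P Q
pellPair-PQ = record { fst-suc = proj₁ ∘ P-Q-suc ; snd-suc = proj₂ ∘ P-Q-suc }

pellPair-Q-2P : PellPair Q (λ n → 2 ℕ.* P n)
pellPair-Q-2P = record
  { fst-suc = λ n → trans (snd-suc pellPair-PQ n) (ℕ.+-comm (2 ℕ.* P n) (Q n))
  ; snd-suc = λ n → trans (cong (2 ℕ.*_) (fst-suc pellPair-PQ n))
                     (trans (ℕ.*-distribˡ-+ 2 (P n) (Q n)) (ℕ.+-comm (2 ℕ.* P n) (2 ℕ.* Q n)))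
  }

pellPair-Dfrom₃ : ∀ t → PellPair (λ s → Dfrom 3 s 2 t) (λ s → Dfrom 3 s 1 t + Dfrom 3 s 3 t)
pellPair-Dfrom₃ t = record
  { fst-suc = λ s → trans (Dfrom₃-suc-2 s t) (D₃-suc s t)
  ; snd-suc = λ s → trans (cong₂ _+_ (Dfrom₃-suc-1 s t) (Dfrom₃-suc-3 s t))
                          (regroup (Dfrom 3 s 1 t) (Dfrom 3 s 2 t) (Dfrom 3 s 3 t))
  }
  where
  regroup : ∀ a b c → (a + b) + (b + c) ≡ 2 ℕ.* b + (a + c)
  regroup = ℕ-Solver.solve-∀

D₃-row1 : ∀ s → D 3 (suc s) 1 ≡ P (suc s)
D₃-row1 s = trans (sym (Dfrom₃-suc-2 s 1))
  (proj₁ (pellPair-unique (pellPair-Dfrom₃ 1) pellPair-PQ refl refl (suc s)))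

D₃-row2 : ∀ s → D 3 (suc s) 2 ≡ Q (suc s)
D₃-row2 s = trans (sym (Dfrom₃-suc-2 s 2))
  (proj₁ (pellPair-unique (pellPair-Dfrom₃ 2) pellPair-Q-2P refl refl (suc s)))

cross : (ℕ → ℕ) → (ℕ → ℕ) → ℕ → ℕ → ℤ
cross x y m n = + x m * + y n - + y m * + x n

pellPair-cross-suc : ∀ {x y} → PellPair x y → ∀ m n → cross x y (suc m) (suc n) ≡ - cross x y m n
pellPair-cross-suc {x} {y} xy m n = begin
  + x (suc m) * + y (suc n) - + y (suc m) * + x (suc n)
    ≡⟨ cong₂ _-_ (cong₂ _*_ (x-suc m) (y-suc n)) (cong₂ _*_ (y-suc m) (x-suc n)) ⟩
  (+ x m ℤ.+ + y m) * (+ 2 * + x n ℤ.+ + y n) - (+ 2 * + x m ℤ.+ + y m) * (+ x n ℤ.+ + y n)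
    ≡⟨ det-identity (+ x m) (+ y m) (+ x n) (+ y n) ⟩
  - (+ x m * + y n - + y m * + x n)
    ∎
  where
  open ≡-Reasoning
  det-identity : ∀ a b c d → (a ℤ.+ b) * (+ 2 * c ℤ.+ d) - (+ 2 * a ℤ.+ b) * (c ℤ.+ d) ≡ - (a * d - b * c)
  det-identity = ℤ-Solver.solve-∀
  x-suc : ∀ k → + x (suc k) ≡ + x k ℤ.+ + y k
  x-suc k = trans (cong +_ (fst-suc xy k)) (ℤ.pos-+ (x k) (y k))
  y-suc : ∀ k → + y (suc k) ≡ + 2 * + x k ℤ.+ + y k
  y-suc k rewrite snd-suc xy k = begin
    + (2 ℕ.* x k + y k)        ≡⟨ ℤ.pos-+ (2 ℕ.* x k) (y k) ⟩
    + (2 ℕ.* x k) ℤ.+ + y k    ≡⟨ cong (ℤ._+ + y k) (ℤ.pos-* 2 (x k)) ⟩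
    + 2 * + x k ℤ.+ + y k      ∎

pellPair-cross : ∀ {x y} → PellPair x y → ∀ m n →
                 cross x y m (m + n) ≡ (- + 1) ^ℤ m * cross x y 0 n
pellPair-cross {x} {y} xy zero n = sym (ℤ.*-identityˡ (cross x y 0 n))
pellPair-cross {x} {y} xy (suc m) n = begin
  cross x y (suc m) (suc (m + n))          ≡⟨ pellPair-cross-suc xy m (m + n) ⟩
  - cross x y m (m + n)                    ≡⟨ cong -_ (pellPair-cross xy m n) ⟩
  - ((- + 1) ^ℤ m * cross x y 0 n)         ≡⟨ ℤ.-1*i≡-i ((- + 1) ^ℤ m * cross x y 0 n) ⟨
  - + 1 * ((- + 1) ^ℤ m * cross x y 0 n)   ≡⟨ ℤ.*-assoc (- + 1) ((- + 1) ^ℤ m) (cross x y 0 n) ⟨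
  (- + 1) ^ℤ suc m * cross x y 0 n         ∎
  where open ≡-Reasoning

P-Q-cross : ∀ s t → cross P Q s (s + t) ≡ (- + 1) ^ℤ (s + 1) * + P t
P-Q-cross s t = begin
  cross P Q s (s + t)                       ≡⟨ pellPair-cross pellPair-PQ s t ⟩
  (- + 1) ^ℤ s * (+ 0 * + Q t - + 1 * + P t) ≡⟨ cong ((- + 1) ^ℤ s *_) (cross₀ (+ Q t) (+ P t)) ⟩
  (- + 1) ^ℤ s * (- + 1 * + P t)             ≡⟨ ℤ.*-assoc ((- + 1) ^ℤ s) (- + 1) (+ P t) ⟨
  (- + 1) ^ℤ s * (- + 1) ^ℤ 1 * + P t        ≡⟨ cong (_* + P t) (ℤ.^-distribˡ-+-* (- + 1) s 1) ⟨
  (- + 1) ^ℤ (s + 1) * + P t                 ∎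
  where
  open ≡-Reasoning
  cross₀ : ∀ q p → + 0 * q - + 1 * p ≡ - + 1 * p
  cross₀ = ℤ-Solver.solve-∀

proposition4p5 : ((s : ℕ) → s ≥ 1 → (D 3 s 1 ≡ P s) × (D 3 s 2 ≡ Q s))
    × ((s t : ℕ) → s ≥ 1 → t ≥ 1 →
    (+ D 3 s 1) * (+ D 3 (s + t) 2) - (+ D 3 s 2) * (+ D 3 (s + t) 1)
    ≡ ((- (+ 1)) ^ℤ (s + 1)) * (+ D 3 t 1))
proposition4p5 = D₃-Pell , D₃-cross
  where
  D₃-Pell : (s : ℕ) → s ≥ 1 → (D 3 s 1 ≡ P s) × (D 3 s 2 ≡ Q s)
  D₃-Pell (suc s) _ = D₃-row1 s , D₃-row2 s

  D₃-cross : (s t : ℕ) → s ≥ 1 → t ≥ 1 →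
             cross (λ n → D 3 n 1) (λ n → D 3 n 2) s (s + t) ≡ (- + 1) ^ℤ (s + 1) * + D 3 t 1
  D₃-cross (suc s) (suc t) _ _
    rewrite D₃-row1 s | D₃-row2 s | D₃-row1 (s + suc t) | D₃-row2 (s + suc t) | D₃-row1 t
    = P-Q-cross (suc s) (suc t)
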